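{- Let $T$ be a semi-complete digraph on $n$ vertices that admits an ordering $(v_1,\ldots,v_n)$ of cost at most $k$. Then the width of this ordering is at most $(4k)^{2/3}$.
   Context: A simple digraph (no loops, no multiple arcs; opposite arcs allowed) $T$ is semi-complete if for every pair of distinct vertices $v,w$ at least one of $(v,w)$, $(w,v)$ is an arc. The cost of an ordering $(v_1,\ldots,v_n)$ is $\sum_{(v_i,v_j)\in E(T)}(i-j)\cdot[i>j]$. The width of the ordering is $\max_{1\le t\le n-1}|E(\{v_{t+1},\ldots,v_n\},\{v_1,\ldots,v_t\})|$, where $E(A,B)$ is the set of arcs with tail in $A$ and head in $B$. -}

module Defs where

open import Data.Nat using (ℕ; zero; suc; _+_; _∸_; _<ᵇ_; _⊔_)
open import Data.Bool using (Bool; true; false; if_then_else_; _∧_)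
open import Data.Fin using (Fin; toℕ; _≟_)
open import Data.Fin.Permutation using (Permutation′; _⟨$⟩ʳ_)
open import Data.Nat.ListAction using (sum)
open import Data.List using (List; map; allFin; foldr; applyUpTo)
open import Data.Sum using (_⊎_)
open import Relation.Binary.PropositionalEquality using (_≡_; _≢_)

-- A digraph on vertex set Fin n, given by its arc indicator:
-- (v , w) is an arc iff Arc v w ≡ true.  At most one arc per ordered pair,
-- so no multiple arcs by construction.
Digraph : ℕ → Set
Digraph n = Fin n → Fin n → Bool

Loopless : ∀ {n} → Digraph n → Set
Loopless {n} T = (v : Fin n) → T v v ≡ false

SemiComplete : ∀ {n} → Digraph n → Set
SemiComplete {n} T = (v w : Fin n) → v ≢ w → (T v w ≡ true) ⊎ (T w v ≡ true)

-- An ordering (v_1,…,v_n) of the vertices: position p (0-indexed, i.e. p = i-1)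
-- holds vertex  σ ⟨$⟩ʳ p.
Ordering : ℕ → Set
Ordering n = Permutation′ n

ΣFin : ∀ n → (Fin n → ℕ) → ℕ
ΣFin n f = sum (map f (allFin n))

cost : ∀ {n} → Digraph n → Ordering n → ℕ
cost {n} T σ =
  ΣFin n λ i → ΣFin n λ j →
    if T (σ ⟨$⟩ʳ i) (σ ⟨$⟩ʳ j) ∧ (toℕ j <ᵇ toℕ i)
    then toℕ i ∸ toℕ j else 0

-- |E({v_{t+1},…,v_n},{v_1,…,v_t})|: arcs with tail at (1-indexed) position > t
-- and head at position ≤ t; with 0-indexed positions: tail pos ≥ t, head pos < t.
cut : ∀ {n} → Digraph n → Ordering n → ℕ → ℕ
cut {n} T σ t =
  ΣFin n λ i → ΣFin n λ j →
    if T (σ ⟨$⟩ʳ i) (σ ⟨$⟩ʳ j) ∧ (toℕ j <ᵇ t) ∧ (t <ᵇ suc (toℕ i))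
    then 1 else 0

-- width: max over 1 ≤ t ≤ n-1 of cut t  (0 if n ≤ 1)
width : ∀ {n} → Digraph n → Ordering n → ℕ
width {n} T σ = foldr _⊔_ 0 (applyUpTo (λ t → cut T σ (suc t)) (n ∸ 1))

-- Fix a cut t of the ordering, of size w, and an integer m = 1 + d ≥ 1. A backward
-- arc across the cut of length at least m contributes at least m to the cost; the
-- backward arcs across the cut of length less than m join a pair of positions
-- j < t ≤ i with i − j ≤ d, and there are only 1 + 2 + ⋯ + d such pairs. Hence
-- m·w ≤ k + m·(1 + ⋯ + d). For m = ⌊√w⌋ this gives m·w ≤ 2k, and w < (m + 1)² ≤ 4m²,
-- so w³ ≤ 4(m·w)² ≤ (4k)².
module Submission where

open import Defs
open import Data.Bool using (Bool; true; false; if_then_else_; _∧_)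
open import Data.Fin using (Fin; toℕ)
open import Data.Fin.Permutation using (_⟨$⟩ʳ_)
open import Data.List using ([]; _∷_; map; applyUpTo; tabulate; allFin)
open import Data.List.Properties using (map-cong; map-tabulate; foldr-preservesᵇ)
open import Data.List.Relation.Unary.All.Properties using (applyUpTo⁺₂)
open import Data.Nat using (ℕ; zero; suc; _+_; _*_; _∸_; _^_; _⊔_; _<ᵇ_; _≤_; _<_; z≤n; s≤s; _≤?_; _<?_)
open import Data.Nat.ListAction using (sum)
open import Data.Nat.Properties
open import Data.Nat.Tactic.RingSolver using (solve-∀)
open import Data.Product using (_×_; _,_; ∃-syntax)
open import Data.Sum using ([_,_]′)
open import Function using (_∘_; id)
open import Relation.Nullary using (yes; no; contradiction)
open import Relation.Nullary.Reflects using (ofʸ; ofⁿ)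
open import Relation.Binary.PropositionalEquality using (_≡_; refl; sym; trans; cong; cong₂; subst; module ≡-Reasoning)

module _ {X : Set} where

  sum-map-mono : {f g : X → ℕ} → (∀ x → f x ≤ g x) → ∀ xs → sum (map f xs) ≤ sum (map g xs)
  sum-map-mono f≤g []       = z≤n
  sum-map-mono f≤g (x ∷ xs) = +-mono-≤ (f≤g x) (sum-map-mono f≤g xs)

  sum-map-+ : ∀ (f g : X → ℕ) xs → sum (map (λ x → f x + g x) xs) ≡ sum (map f xs) + sum (map g xs)
  sum-map-+ f g []       = refl
  sum-map-+ f g (x ∷ xs) rewrite sum-map-+ f g xs = interchange (f x) (g x) _ _
    where
    interchange : ∀ a b c d → a + b + (c + d) ≡ a + c + (b + d)
    interchange = solve-∀

  sum-map-*ˡ : ∀ a (f : X → ℕ) xs → sum (map (λ x → a * f x) xs) ≡ a * sum (map f xs)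
  sum-map-*ˡ a f []       = sym (*-zeroʳ a)
  sum-map-*ˡ a f (x ∷ xs) rewrite sum-map-*ˡ a f xs = sym (*-distribˡ-+ a (f x) _)

  sum-map-outer-product : ∀ (f g : X → ℕ) xs ys →
    sum (map (λ x → sum (map (λ y → f x * g y) ys)) xs) ≡ sum (map f xs) * sum (map g ys)
  sum-map-outer-product f g xs ys = begin
    sum (map (λ x → sum (map (λ y → f x * g y) ys)) xs)
      ≡⟨ cong sum (map-cong (λ x → sum-map-*ˡ (f x) g ys) xs) ⟩
    sum (map (λ x → f x * G) xs)
      ≡⟨ cong sum (map-cong (λ x → *-comm (f x) G) xs) ⟩
    sum (map (λ x → G * f x) xs)
      ≡⟨ sum-map-*ˡ G f xs ⟩
    G * sum (map f xs)
      ≡⟨ *-comm G _ ⟩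
    sum (map f xs) * G ∎
    where
    open ≡-Reasoning
    G = sum (map g ys)

sum-applyUpTo-0 : ∀ n → sum (applyUpTo (λ _ → 0) n) ≡ 0
sum-applyUpTo-0 zero    = refl
sum-applyUpTo-0 (suc n) = sum-applyUpTo-0 n

tabulate-toℕ : ∀ {A : Set} n (h : ℕ → A) → tabulate (h ∘ toℕ {n}) ≡ applyUpTo h n
tabulate-toℕ zero    h = refl
tabulate-toℕ (suc n) h = cong (h 0 ∷_) (tabulate-toℕ n (h ∘ suc))

ΣFin-toℕ : ∀ n (h : ℕ → ℕ) → ΣFin n (h ∘ toℕ) ≡ sum (applyUpTo h n)
ΣFin-toℕ n h = cong sum (trans (map-tabulate id (h ∘ toℕ)) (tabulate-toℕ n h))

triangle : ℕ → ℕ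
triangle zero    = 0
triangle (suc d) = suc d + triangle d

2*triangle : ∀ d → 2 * triangle d ≡ d * suc d
2*triangle zero    = refl
2*triangle (suc d) = begin
  2 * (suc d + triangle d)     ≡⟨ *-distribˡ-+ 2 (suc d) (triangle d) ⟩
  2 * suc d + 2 * triangle d   ≡⟨ cong (2 * suc d +_) (2*triangle d) ⟩
  2 * suc d + d * suc d        ≡⟨ sym (*-distribʳ-+ (suc d) 2 d) ⟩
  (2 + d) * suc d              ≡⟨ *-comm (2 + d) (suc d) ⟩
  suc d * suc (suc d)          ∎
  where open ≡-Reasoning

m*0≤n : ∀ m {n} → m * 0 ≤ n
m*0≤n m = ≤-trans (≤-reflexive (*-zeroʳ m)) z≤n

ramp : ℕ → ℕ → ℕ → ℕ
ramp zero    d i       = d ∸ i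
ramp (suc t) d zero    = 0
ramp (suc t) d (suc i) = ramp t d i

ramp-≥ : ∀ t d i → t ≤ i → ramp t d i ≡ d ∸ (i ∸ t)
ramp-≥ zero    d i       _         = refl
ramp-≥ (suc t) d (suc i) (s≤s t≤i) = ramp-≥ t d i t≤i

sum-countdown≤triangle : ∀ n d → sum (applyUpTo (d ∸_) n) ≤ triangle d
sum-countdown≤triangle zero    d       = z≤n
sum-countdown≤triangle (suc n) zero    = ≤-reflexive (sum-applyUpTo-0 n)
sum-countdown≤triangle (suc n) (suc d) = +-monoʳ-≤ (suc d) (sum-countdown≤triangle n d)

sum-ramp≤triangle : ∀ n t d → sum (applyUpTo (ramp t d) n) ≤ triangle d
sum-ramp≤triangle n       zero    d = sum-countdown≤triangle n d
sum-ramp≤triangle zero    (suc t) d = z≤n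
sum-ramp≤triangle (suc n) (suc t) d = sum-ramp≤triangle n t d

-- window lo l is the indicator function of the interval [lo , lo + l).
window : ℕ → ℕ → ℕ → ℕ
window zero     zero    j       = 0
window zero     (suc l) zero    = 1
window zero     (suc l) (suc j) = window zero l j
window (suc lo) l       zero    = 0
window (suc lo) l       (suc j) = window lo l j

window-inside : ∀ lo l j → lo ≤ j → j < lo + l → window lo l j ≡ 1
window-inside zero     (suc l) zero    _          _         = refl
window-inside zero     (suc l) (suc j) _          (s≤s j<l) = window-inside zero l j z≤n j<l
window-inside (suc lo) l       (suc j) (s≤s lo≤j) (s≤s j<)  = window-inside lo l j lo≤j j<

sum-window≤length : ∀ n lo l → sum (applyUpTo (window lo l) n) ≤ l
sum-window≤length zero    lo       l       = z≤n
sum-window≤length (suc n) zero     zero    = ≤-reflexive (sum-applyUpTo-0 n)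
sum-window≤length (suc n) zero     (suc l) = s≤s (sum-window≤length n zero l)
sum-window≤length (suc n) (suc lo) l       = sum-window≤length n lo l

-- A backward arc from position i to position j across the cut at t pays its length
-- i ∸ j; if that is below 1 + d, the arc is short and is charged to
-- ramp t d i * window (t ∸ suc d) (suc d) j instead.
crossing-charge : ∀ {i j t} d → j < t → t ≤ i →
  suc d ≤ i ∸ j + ramp t d i * window (t ∸ suc d) (suc d) j
crossing-charge {i} {j} {t} d j<t t≤i with t ≤? j + suc d
... | yes short = begin
  suc d                        ≤⟨ s≤s (m≤n+m∸n d (i ∸ t)) ⟩
  suc (i ∸ t) + (d ∸ (i ∸ t))  ≤⟨ +-monoˡ-≤ _ (∸-monoʳ-< j<t t≤i) ⟩
  i ∸ j + (d ∸ (i ∸ t))        ≡⟨ cong (i ∸ j +_) (sym charge≡) ⟩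
  i ∸ j + ramp t d i * window (t ∸ suc d) (suc d) j ∎
  where
  open ≤-Reasoning
  lo≤j : t ∸ suc d ≤ j
  lo≤j = m≤n+o⇒m∸n≤o t (suc d) (≤-trans short (≤-reflexive (+-comm j (suc d))))
  j<hi : j < t ∸ suc d + suc d
  j<hi = <-≤-trans j<t (≤-trans (m≤n+m∸n t (suc d)) (≤-reflexive (+-comm (suc d) _)))
  charge≡ : ramp t d i * window (t ∸ suc d) (suc d) j ≡ d ∸ (i ∸ t)
  charge≡ rewrite window-inside (t ∸ suc d) (suc d) j lo≤j j<hi =
    trans (*-identityʳ (ramp t d i)) (ramp-≥ t d i t≤i)
... | no long = begin
  suc d      ≤⟨ m+n≤o⇒m≤o∸n (suc d) (≤-trans (≤-reflexive (+-comm (suc d) j)) (<⇒≤ (≰⇒> long))) ⟩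
  t ∸ j      ≤⟨ ∸-monoˡ-≤ j t≤i ⟩
  i ∸ j      ≤⟨ m≤m+n (i ∸ j) _ ⟩
  i ∸ j + _  ∎
  where open ≤-Reasoning

module _ {n : ℕ} (T : Digraph n) (σ : Ordering n) where

  arc : Fin n → Fin n → Bool
  arc i j = T (σ ⟨$⟩ʳ i) (σ ⟨$⟩ʳ j)

  crossing : ℕ → Fin n → Fin n → ℕ
  crossing t i j = if arc i j ∧ (toℕ j <ᵇ t) ∧ (t <ᵇ suc (toℕ i)) then 1 else 0

  cost-term : Fin n → Fin n → ℕ
  cost-term i j = if arc i j ∧ (toℕ j <ᵇ toℕ i) then toℕ i ∸ toℕ j else 0

  crossing-charge-term : ∀ t d i j →
    suc d * crossing t i j ≤ cost-term i j + ramp t d (toℕ i) * window (t ∸ suc d) (suc d) (toℕ j)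
  crossing-charge-term t d i j with arc i j
  ... | false = m*0≤n (suc d)
  ... | true with toℕ j <ᵇ t | <ᵇ-reflects-< (toℕ j) t | t <ᵇ suc (toℕ i) | <ᵇ-reflects-< t (suc (toℕ i))
  ...   | false | _         | _     | _                  = m*0≤n (suc d)
  ...   | true  | _         | false | _                  = m*0≤n (suc d)
  ...   | true  | ofʸ j<t   | true  | ofʸ (s≤s t≤i)
          with toℕ j <ᵇ toℕ i | <ᵇ-reflects-< (toℕ j) (toℕ i)
  ...     | true  | _       = ≤-trans (≤-reflexive (*-identityʳ (suc d))) (crossing-charge d j<t t≤i)
  ...     | false | ofⁿ j≮i = contradiction (<-≤-trans j<t t≤i) j≮i

  scaled-cut≤cost+charge : ∀ t d → suc d * cut T σ t ≤ cost T σ + triangle d * suc d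
  scaled-cut≤cost+charge t d = begin
    suc d * ΣFin n (λ i → ΣFin n (crossing t i))
      ≡⟨ sym (sum-map-*ˡ (suc d) _ (allFin n)) ⟩
    ΣFin n (λ i → suc d * ΣFin n (crossing t i))
      ≡⟨ cong sum (map-cong (λ i → sym (sum-map-*ˡ (suc d) (crossing t i) (allFin n))) (allFin n)) ⟩
    ΣFin n (λ i → ΣFin n (λ j → suc d * crossing t i j))
      ≤⟨ sum-map-mono (λ i → sum-map-mono (crossing-charge-term t d i) (allFin n)) (allFin n) ⟩
    ΣFin n (λ i → ΣFin n (λ j → cost-term i j + a i * b j))
      ≡⟨ cong sum (map-cong (λ i → sum-map-+ (cost-term i) (λ j → a i * b j) (allFin n)) (allFin n)) ⟩
    ΣFin n (λ i → ΣFin n (cost-term i) + ΣFin n (λ j → a i * b j))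
      ≡⟨ sum-map-+ _ _ (allFin n) ⟩
    cost T σ + ΣFin n (λ i → ΣFin n (λ j → a i * b j))
      ≡⟨ cong (cost T σ +_) (sum-map-outer-product a b (allFin n) (allFin n)) ⟩
    cost T σ + ΣFin n a * ΣFin n b
      ≡⟨ cong₂ (λ A B → cost T σ + A * B) (ΣFin-toℕ n (ramp t d)) (ΣFin-toℕ n (window (t ∸ suc d) (suc d))) ⟩
    cost T σ + sum (applyUpTo (ramp t d) n) * sum (applyUpTo (window (t ∸ suc d) (suc d)) n)
      ≤⟨ +-monoʳ-≤ (cost T σ) (*-mono-≤ (sum-ramp≤triangle n t d) (sum-window≤length n (t ∸ suc d) (suc d))) ⟩
    cost T σ + triangle d * suc d ∎
    where
    open ≤-Reasoning
    a b : Fin n → ℕ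
    a i = ramp t d (toℕ i)
    b j = window (t ∸ suc d) (suc d) (toℕ j)

floor-sqrt : ∀ w → ∃[ m ] m * m ≤ w × w < suc m * suc m
floor-sqrt zero = 0 , z≤n , s≤s z≤n
floor-sqrt (suc w) with floor-sqrt w
... | m , m²≤w , w<[1+m]² with suc w <? suc m * suc m
...   | yes w+1<[1+m]² = m , ≤-trans m²≤w (n≤1+n w) , w+1<[1+m]²
...   | no  w+1≮[1+m]² = suc m , ≮⇒≥ w+1≮[1+m]² ,
          ≤-<-trans w<[1+m]² (*-mono-< (n<1+n (suc m)) (n<1+n (suc m)))

-- With m² ≤ w the charge m·(1 + ⋯ + (m − 1)) = m²(m − 1)/2 is at most m·w/2.
scaled-cut≤2k : ∀ {w k} d → suc d * suc d ≤ w →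
  suc d * w ≤ k + triangle d * suc d → suc d * w ≤ 2 * k
scaled-cut≤2k {w} {k} d m²≤w mw≤ = +-cancelʳ-≤ X X (2 * k) (begin
  X + X                          ≡⟨ cong (X +_) (sym (+-identityʳ X)) ⟩
  2 * X                          ≤⟨ *-monoʳ-≤ 2 mw≤ ⟩
  2 * (k + triangle d * m)       ≡⟨ *-distribˡ-+ 2 k _ ⟩
  2 * k + 2 * (triangle d * m)   ≡⟨ cong (2 * k +_) (sym (*-assoc 2 (triangle d) m)) ⟩
  2 * k + 2 * triangle d * m     ≡⟨ cong (λ z → 2 * k + z * m) (2*triangle d) ⟩
  2 * k + d * m * m              ≤⟨ +-monoʳ-≤ (2 * k) (*-monoˡ-≤ m (*-monoˡ-≤ m (n≤1+n d))) ⟩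
  2 * k + m * m * m              ≡⟨ cong (2 * k +_) (*-comm (m * m) m) ⟩
  2 * k + m * (m * m)            ≤⟨ +-monoʳ-≤ (2 * k) (*-monoʳ-≤ m m²≤w) ⟩
  2 * k + X                      ∎)
  where
  open ≤-Reasoning
  m = suc d
  X = m * w

cube≤square : ∀ {w k} → (∀ d → suc d * w ≤ k + triangle d * suc d) → w ^ 3 ≤ (4 * k) ^ 2
cube≤square {zero}  _ = z≤n
cube≤square {suc v} {k} mw≤ with floor-sqrt (suc v)
... | zero  , _    , s≤s ()
... | suc d , m²≤w , w<[1+m]² = begin
  w ^ 3                  ≡⟨ cube w ⟩
  w * (w * w)            ≤⟨ *-monoˡ-≤ (w * w) w≤4m² ⟩
  4 * (m * m) * (w * w)  ≡⟨ regroup m w ⟩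
  4 * (X * X)            ≤⟨ *-monoʳ-≤ 4 (*-mono-≤ X≤2k X≤2k) ⟩
  4 * (2 * k * (2 * k))  ≡⟨ square-of-4* k ⟩
  (4 * k) ^ 2            ∎
  where
  open ≤-Reasoning
  cube : ∀ x → x ^ 3 ≡ x * (x * x)
  cube x = cong (λ z → x * (x * z)) (*-identityʳ x)
  four-squares : ∀ x → 2 * x * (2 * x) ≡ 4 * (x * x)
  four-squares = solve-∀
  square-of-4* : ∀ x → 4 * (2 * x * (2 * x)) ≡ 4 * x * (4 * x * 1)
  square-of-4* = solve-∀
  regroup : ∀ m w → 4 * (m * m) * (w * w) ≡ 4 * (m * w * (m * w))
  regroup = solve-∀
  w = suc v
  m = suc d
  X = m * w
  X≤2k : X ≤ 2 * k
  X≤2k = scaled-cut≤2k d m²≤w (mw≤ d)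
  1+m≤2m : suc m ≤ 2 * m
  1+m≤2m = ≤-trans (≤-reflexive (+-comm 1 m)) (+-monoʳ-≤ m (s≤s (z≤n {d + 0})))
  w≤4m² : w ≤ 4 * (m * m)
  w≤4m² = begin
    w                      ≤⟨ <⇒≤ w<[1+m]² ⟩
    suc m * suc m          ≤⟨ *-mono-≤ 1+m≤2m 1+m≤2m ⟩
    2 * m * (2 * m)        ≡⟨ four-squares m ⟩
    4 * (m * m)            ∎

⊔-preserves : ∀ (P : ℕ → Set) {x y} → P x → P y → P (x ⊔ y)
⊔-preserves P {x} {y} px py = [ (λ eq → subst P (sym eq) px) , (λ eq → subst P (sym eq) py) ]′ (⊔-sel x y)

lemma3p10 : (n : ℕ) (T : Digraph n) → Loopless T → SemiComplete T →
    (σ : Ordering n) (k : ℕ) → cost T σ ≤ k →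
    width T σ ^ 3 ≤ (4 * k) ^ 2
lemma3p10 n T _ _ σ k cost≤k =
  foldr-preservesᵇ {P = Bounded} (λ {x} {y} → ⊔-preserves Bounded {x} {y}) z≤n
    (applyUpTo⁺₂ (λ t → cut T σ (suc t)) (n ∸ 1) cut-bounded)
  where
  Bounded : ℕ → Set
  Bounded w = w ^ 3 ≤ (4 * k) ^ 2
  cut-bounded : ∀ t → Bounded (cut T σ (suc t))
  cut-bounded t = cube≤square λ d →
    ≤-trans (scaled-cut≤cost+charge T σ (suc t) d) (+-monoˡ-≤ _ cost≤k)
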